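{- Let $d\ge 1$ be an integer, let $\mathbf{e}_1,\dots,\mathbf{e}_d$ be the standard unit vectors of $\mathbb{R}^d$, and let $C_d\subset\mathbb{R}^d$ be the convex hull of the set \[\{\pm \mathbf{e}_i : 1\le i\le d\}\cup\{\pm(\mathbf{e}_i+\cdots+\mathbf{e}_j): 1\le i<j\le d-1\}\cup\{\pm(2\mathbf{e}_i+\cdots+2\mathbf{e}_{d-1}+\mathbf{e}_d): 1\le i\le d-1\}.\] Let $C_d^*=\{u\in\mathbb{R}^d : \langle u,v\rangle\le 1 \text{ for all } v\in C_d\}$ be its dual polytope. Then for every positive integer $k$, \[|kC_d^*\cap\mathbb{Z}^d|=(k+1)^d+k^d,\] where $kC_d^*=\{k\alpha:\alpha\in C_d^*\}$.
   Context: $\langle\cdot,\cdot\rangle$ denotes the standard inner product on $\mathbb{R}^d$. $C_d$ is called the root polytope of type C. -}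

module Defs where

open import Data.Nat as ℕ using (ℕ; zero; suc; _≤ᵇ_; _<ᵇ_)
open import Data.Integer as ℤ using (ℤ; +_)
open import Data.Rational as ℚ using (ℚ; 0ℚ; 1ℚ; _/_)
open import Data.Fin using (Fin; toℕ; _≟_)
open import Data.Bool using (Bool; true; false; if_then_else_; _∧_)
open import Data.Vec using (Vec; lookup)
open import Data.List using (List; []; _∷_)
open import Data.Product using (Σ; _×_; ∃)
open import Relation.Nullary.Decidable using (⌊_⌋)
open import Relation.Binary.PropositionalEquality using (_≡_)

ℚ^ : ℕ → Set
ℚ^ d = Fin d → ℚ

sumFin : ∀ {d} → (Fin d → ℚ) → ℚ
sumFin {zero} f = 0ℚ
sumFin {suc d} f = f Fin.zero ℚ.+ sumFin (λ i → f (Fin.suc i))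

⟨_,_⟩ : ∀ {d} → ℚ^ d → ℚ^ d → ℚ
⟨ u , v ⟩ = sumFin (λ i → u i ℚ.* v i)

neg : ∀ {d} → ℚ^ d → ℚ^ d
neg v i = ℚ.- (v i)

-- Generators (0-based indices; the paper's index i corresponds to a = i - 1).
-- e_a
eVec : ∀ {d} → ℕ → ℚ^ d
eVec a m = if ⌊ toℕ m ℕ.≟ a ⌋ then 1ℚ else 0ℚ

blockVec : ∀ {d} → ℕ → ℕ → ℚ^ d
blockVec a b m = if (a ≤ᵇ toℕ m) ∧ (toℕ m ≤ᵇ b) then 1ℚ else 0ℚ

tailVec : ∀ {d} → ℕ → ℚ^ d
tailVec {d} a m =
  if suc (toℕ m) ℕ.≡ᵇ d then 1ℚ
  else (if a ≤ᵇ toℕ m then (+ 2 / 1) else 0ℚ)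

-- The generating set of C_d (paper indices 1 ≤ i < j ≤ d-1 become a < b, b + 2 ≤ d).
data Gen (d : ℕ) : ℚ^ d → Set where
  gE    : ∀ a → a ℕ.< d → Gen d (eVec a)
  gE⁻   : ∀ a → a ℕ.< d → Gen d (neg (eVec a))
  gB    : ∀ a b → a ℕ.< b → suc (suc b) ℕ.≤ d → Gen d (blockVec a b)
  gB⁻   : ∀ a b → a ℕ.< b → suc (suc b) ℕ.≤ d → Gen d (neg (blockVec a b))
  gT    : ∀ a → suc (suc a) ℕ.≤ d → Gen d (tailVec a)
  gT⁻   : ∀ a → suc (suc a) ℕ.≤ d → Gen d (neg (tailVec a))

data ConvComb {d : ℕ} (P : ℚ^ d → Set) : ℚ → ℚ^ d → Set where
  cc-nil  : ConvComb P 0ℚ (λ _ → 0ℚ)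
  cc-cons : ∀ {s x} (λ' : ℚ) (p : ℚ^ d) → 0ℚ ℚ.≤ λ' → P p →
            ConvComb P s x →
            ConvComb P (λ' ℚ.+ s) (λ i → λ' ℚ.* p i ℚ.+ x i)

ConvHull : ∀ {d} → (ℚ^ d → Set) → ℚ^ d → Set
ConvHull P v = ∃ λ x → ConvComb P 1ℚ x × (∀ i → x i ≡ v i)

C : (d : ℕ) → ℚ^ d → Set
C d = ConvHull (Gen d)

CDual : (d : ℕ) → ℚ^ d → Set
CDual d u = ∀ v → C d v → ⟨ u , v ⟩ ℚ.≤ 1ℚ

InDilate : (d k : ℕ) → ℚ^ d → Set
InDilate d k u = ∃ λ α → CDual d α × (∀ i → u i ≡ (+ k / 1) ℚ.* α i)

toℚ^ : ∀ {d} → Vec ℤ d → ℚ^ d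
toℚ^ z i = lookup z i / 1

LatticePt : (d k : ℕ) → Vec ℤ d → Set
LatticePt d k z = InDilate d k (toℚ^ z)

-- Since C_d is the convex hull of its generators, an integer point z lies in kC_d^* iff
-- ⟨z, g⟩ ≤ k for every generator g. Write z = Δ_K(w), i.e. z_i = w_{i+1} − w_i for i < d
-- and z_d = K − 2w_d. The generators pair with Δ_K(w) to ±(w_j − w_i) and ±(K − 2w_i), so for
-- K ∈ {k, k − 1} the conditions |K − 2w_i| ≤ k say exactly that every w_i lies in [0, K], and
-- then |w_j − w_i| ≤ K ≤ k holds automatically. Every z ∈ kC_d^* arises this way: the parity
-- of k − z_d decides between K = k and K = k − 1, and w is recovered from z by summation.
-- The two families are told apart by the parity of z_d and Δ_K is injective, so the lattice
-- points are counted by the boxes [0, k]^d and [0, k − 1]^d.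

module Submission where

open import Defs
open import Data.Nat as ℕ using (ℕ; zero; suc; _≤_; _+_; _^_; _≡ᵇ_; _≤ᵇ_; _<ᵇ_)
import Data.Nat.Properties as ℕP
open import Data.Integer as ℤ using (ℤ; +_; -[1+_])
import Data.Integer.Properties as ℤP
open import Data.Integer.DivMod using (_/ℕ_; _%ℕ_; n%ℕd<d; a≡a%ℕn+[a/ℕn]*n)
open import Data.Integer.Tactic.RingSolver using (solve-∀)
open import Data.Rational as ℚ using (ℚ; 0ℚ; 1ℚ; _/_; toℚᵘ)
import Data.Rational.Properties as ℚP
import Data.Rational.Unnormalised as ℚᵘ
import Data.Rational.Unnormalised.Properties as ℚᵘP
open import Data.Rational.Solver using (module +-*-Solver)
open import Data.Bool using (true; false; if_then_else_; _∧_)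
open import Data.Fin as Fin using (Fin; toℕ)
open import Data.Vec as Vec using (Vec; []; _∷_)
import Data.Vec.Properties as VecP
open import Data.Vec.Relation.Unary.All as AllV using (All; []; _∷_)
open import Data.List as List using (List; length; map; _++_; upTo; cartesianProductWith)
import Data.List.Properties as ListP
open import Data.List.Membership.Propositional using (_∈_)
open import Data.List.Membership.Propositional.Properties
open import Data.List.Relation.Unary.Unique.Propositional using (Unique)
import Data.List.Relation.Unary.Unique.Propositional.Properties as Unique
import Data.List.Relation.Unary.AllPairs as AllPairs
import Data.List.Relation.Unary.All as ListAll
import Data.List.Relation.Unary.Any as Any
open import Data.Product using (Σ; ∃; _,_; _×_; proj₁; proj₂)
open import Data.Sum using (_⊎_; inj₁; inj₂; [_,_]′)
open import Function using (_∘_)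
open import Function.Bundles using (_⇔_; mk⇔; Equivalence)
open import Relation.Nullary using (¬_)
open import Relation.Nullary.Decidable using (isYes≗does)
open import Relation.Binary.PropositionalEquality

ι : ℤ → ℚ
ι i = i / 1

private
  toℚᵘ-ι : ∀ i → toℚᵘ (ι i) ℚᵘ.≃ ℚᵘ.mkℚᵘ i 0
  toℚᵘ-ι i = ℚP.toℚᵘ-fromℚᵘ (ℚᵘ.mkℚᵘ i 0)

  ≡ι-from-ℚᵘ : ∀ {p} i → toℚᵘ p ℚᵘ.≃ ℚᵘ.mkℚᵘ i 0 → p ≡ ι i
  ≡ι-from-ℚᵘ i e = ℚP.toℚᵘ-injective (ℚᵘP.≃-trans e (ℚᵘP.≃-sym (toℚᵘ-ι i)))

ι-+ : ∀ i j → ι i ℚ.+ ι j ≡ ι (i ℤ.+ j)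
ι-+ i j = ≡ι-from-ℚᵘ (i ℤ.+ j) (ℚᵘP.≃-trans (ℚP.toℚᵘ-homo-+ (ι i) (ι j))
  (ℚᵘP.≃-trans (ℚᵘP.+-cong (toℚᵘ-ι i) (toℚᵘ-ι j)) (ℚᵘ.*≡* (eq i j))))
  where
  eq : ∀ a b → (a ℤ.* + 1 ℤ.+ b ℤ.* + 1) ℤ.* + 1 ≡ (a ℤ.+ b) ℤ.* + 1
  eq = solve-∀

ι-* : ∀ i j → ι i ℚ.* ι j ≡ ι (i ℤ.* j)
ι-* i j = ≡ι-from-ℚᵘ (i ℤ.* j) (ℚᵘP.≃-trans (ℚP.toℚᵘ-homo-* (ι i) (ι j))
  (ℚᵘP.≃-trans (ℚᵘP.*-cong (toℚᵘ-ι i) (toℚᵘ-ι j)) (ℚᵘ.*≡* refl)))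

ι-neg : ∀ i → ℚ.- ι i ≡ ι (ℤ.- i)
ι-neg i = ≡ι-from-ℚᵘ (ℤ.- i) (ℚᵘP.≃-trans (ℚP.toℚᵘ-homo‿- (ι i)) (ℚᵘP.-‿cong (toℚᵘ-ι i)))

ι-mono-≤ : ∀ {i j} → i ℤ.≤ j → ι i ℚ.≤ ι j
ι-mono-≤ {i} {j} i≤j = ℚP.toℚᵘ-cancel-≤
  (ℚᵘP.≤-respˡ-≃ (ℚᵘP.≃-sym (toℚᵘ-ι i)) (ℚᵘP.≤-respʳ-≃ (ℚᵘP.≃-sym (toℚᵘ-ι j))
    (ℚᵘ.*≤* (subst₂ ℤ._≤_ (sym (ℤP.*-identityʳ i)) (sym (ℤP.*-identityʳ j)) i≤j))))

ι-cancel-≤ : ∀ {i j} → ι i ℚ.≤ ι j → i ℤ.≤ j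
ι-cancel-≤ {i} {j} ιi≤ιj with ℚᵘP.≤-respˡ-≃ (toℚᵘ-ι i) (ℚᵘP.≤-respʳ-≃ (toℚᵘ-ι j) (ℚP.toℚᵘ-mono-≤ ιi≤ιj))
... | ℚᵘ.*≤* i*1≤j*1 = subst₂ ℤ._≤_ (ℤP.*-identityʳ i) (ℤP.*-identityʳ j) i*1≤j*1

ι-mono-< : ∀ {i j} → i ℤ.< j → ι i ℚ.< ι j
ι-mono-< {i} {j} i<j = ℚP.toℚᵘ-cancel-<
  (ℚᵘP.<-respˡ-≃ (ℚᵘP.≃-sym (toℚᵘ-ι i)) (ℚᵘP.<-respʳ-≃ (ℚᵘP.≃-sym (toℚᵘ-ι j))
    (ℚᵘ.*<* (subst₂ ℤ._<_ (sym (ℤP.*-identityʳ i)) (sym (ℤP.*-identityʳ j)) i<j))))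

-- Inner products and the dual of a convex hull

sumFin-cong : ∀ {d} {f g : Fin d → ℚ} → (∀ i → f i ≡ g i) → sumFin f ≡ sumFin g
sumFin-cong {zero} f≗g = refl
sumFin-cong {suc d} f≗g = cong₂ ℚ._+_ (f≗g Fin.zero) (sumFin-cong (f≗g ∘ Fin.suc))

sumFin-zero : ∀ d → sumFin {d} (λ _ → 0ℚ) ≡ 0ℚ
sumFin-zero zero = refl
sumFin-zero (suc d) = cong (0ℚ ℚ.+_) (sumFin-zero d)

sumFin-+ : ∀ {d} (f g : Fin d → ℚ) → sumFin (λ i → f i ℚ.+ g i) ≡ sumFin f ℚ.+ sumFin g
sumFin-+ {zero} f g = refl
sumFin-+ {suc d} f g = trans (cong (f Fin.zero ℚ.+ g Fin.zero ℚ.+_) (sumFin-+ (f ∘ Fin.suc) (g ∘ Fin.suc)))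
  (interchange (f Fin.zero) (g Fin.zero) (sumFin (f ∘ Fin.suc)) (sumFin (g ∘ Fin.suc)))
  where
  open +-*-Solver
  interchange : ∀ a b c d → (a ℚ.+ b) ℚ.+ (c ℚ.+ d) ≡ (a ℚ.+ c) ℚ.+ (b ℚ.+ d)
  interchange = solve 4 (λ a b c d → (a :+ b) :+ (c :+ d) := (a :+ c) :+ (b :+ d)) refl

*-distribˡ-sumFin : ∀ {d} c (f : Fin d → ℚ) → c ℚ.* sumFin f ≡ sumFin (λ i → c ℚ.* f i)
*-distribˡ-sumFin {zero} c f = ℚP.*-zeroʳ c
*-distribˡ-sumFin {suc d} c f =
  trans (ℚP.*-distribˡ-+ c _ _) (cong (c ℚ.* f Fin.zero ℚ.+_) (*-distribˡ-sumFin c (f ∘ Fin.suc)))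

⟨⟩-cong : ∀ {d} (u : ℚ^ d) {v w : ℚ^ d} → (∀ i → v i ≡ w i) → ⟨ u , v ⟩ ≡ ⟨ u , w ⟩
⟨⟩-cong u v≗w = sumFin-cong (λ i → cong (u i ℚ.*_) (v≗w i))

⟨⟩-zeroʳ : ∀ {d} (u : ℚ^ d) → ⟨ u , (λ _ → 0ℚ) ⟩ ≡ 0ℚ
⟨⟩-zeroʳ {d} u = trans (sumFin-cong (λ i → ℚP.*-zeroʳ (u i))) (sumFin-zero d)

⟨⟩-linearʳ : ∀ {d} (u : ℚ^ d) c p x →
  ⟨ u , (λ i → c ℚ.* p i ℚ.+ x i) ⟩ ≡ c ℚ.* ⟨ u , p ⟩ ℚ.+ ⟨ u , x ⟩
⟨⟩-linearʳ u c p x = begin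
  ⟨ u , (λ i → c ℚ.* p i ℚ.+ x i) ⟩                  ≡⟨ sumFin-cong (λ i → distrib (u i) c (p i) (x i)) ⟩
  sumFin (λ i → c ℚ.* (u i ℚ.* p i) ℚ.+ u i ℚ.* x i) ≡⟨ sumFin-+ (λ i → c ℚ.* (u i ℚ.* p i)) (λ i → u i ℚ.* x i) ⟩
  sumFin (λ i → c ℚ.* (u i ℚ.* p i)) ℚ.+ ⟨ u , x ⟩   ≡⟨ cong (ℚ._+ ⟨ u , x ⟩) (*-distribˡ-sumFin c (λ i → u i ℚ.* p i)) ⟨
  c ℚ.* ⟨ u , p ⟩ ℚ.+ ⟨ u , x ⟩                      ∎
  where
  open ≡-Reasoning
  open +-*-Solver
  distrib : ∀ a c p x → a ℚ.* (c ℚ.* p ℚ.+ x) ≡ c ℚ.* (a ℚ.* p) ℚ.+ a ℚ.* x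
  distrib = solve 4 (λ a c p x → a :* (c :* p :+ x) := c :* (a :* p) :+ a :* x) refl

⟨⟩-scaleˡ : ∀ {d} c {u v : ℚ^ d} (p : ℚ^ d) → (∀ i → u i ≡ c ℚ.* v i) →
  ⟨ u , p ⟩ ≡ c ℚ.* ⟨ v , p ⟩
⟨⟩-scaleˡ c {u} {v} p u≗cv = trans
  (sumFin-cong (λ i → trans (cong (ℚ._* p i) (u≗cv i)) (ℚP.*-assoc c (v i) (p i))))
  (sym (*-distribˡ-sumFin c (λ i → v i ℚ.* p i)))

convComb-bound : ∀ {d} {P : ℚ^ d → Set} (u : ℚ^ d) → (∀ p → P p → ⟨ u , p ⟩ ℚ.≤ 1ℚ) →
  ∀ {s x} → ConvComb P s x → ⟨ u , x ⟩ ℚ.≤ s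
convComb-bound u bound cc-nil = ℚP.≤-reflexive (⟨⟩-zeroʳ u)
convComb-bound u bound (cc-cons {s} {x} λ' p 0≤λ' Pp comb) = begin
  ⟨ u , (λ i → λ' ℚ.* p i ℚ.+ x i) ⟩ ≡⟨ ⟨⟩-linearʳ u λ' p x ⟩
  λ' ℚ.* ⟨ u , p ⟩ ℚ.+ ⟨ u , x ⟩    ≤⟨ ℚP.+-mono-≤ (ℚP.*-monoˡ-≤-nonNeg λ' {{ℚ.nonNegative 0≤λ'}} (bound p Pp))
                                                   (convComb-bound u bound comb) ⟩
  λ' ℚ.* 1ℚ ℚ.+ s                   ≡⟨ cong (ℚ._+ s) (ℚP.*-identityʳ λ') ⟩
  λ' ℚ.+ s                          ∎
  where open ℚP.≤-Reasoning

convHull-bound : ∀ {d} {P : ℚ^ d → Set} (u : ℚ^ d) → (∀ p → P p → ⟨ u , p ⟩ ℚ.≤ 1ℚ) →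
  ∀ v → ConvHull P v → ⟨ u , v ⟩ ℚ.≤ 1ℚ
convHull-bound u bound v (x , comb , x≗v) = subst (ℚ._≤ 1ℚ) (⟨⟩-cong u x≗v) (convComb-bound u bound comb)

∈-convHull : ∀ {d} {P : ℚ^ d → Set} {p} → P p → ConvHull P p
∈-convHull {p = p} Pp = (λ i → 1ℚ ℚ.* p i ℚ.+ 0ℚ)
  , cc-cons 1ℚ p (ℚP.nonNegative⁻¹ 1ℚ) Pp cc-nil
  , λ i → trans (ℚP.+-identityʳ _) (ℚP.*-identityˡ (p i))

inDilate⇔ : ∀ d k (u : ℚ^ d) → InDilate d (suc k) u ⇔ (∀ p → Gen d p → ⟨ u , p ⟩ ℚ.≤ ι (+ suc k))
inDilate⇔ d k u = mk⇔ bounded dilate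
  where
  K = ι (+ suc k)
  instance
    K-positive : ℚ.Positive K
    K-positive = ℚ.positive (ι-mono-< {+ 0} {+ suc k} (ℤ.+<+ (ℕ.s≤s ℕ.z≤n)))
    K-nonZero : ℚ.NonZero K
    K-nonZero = ℚP.pos⇒nonZero K
    K⁻¹-nonNeg : ℚ.NonNegative (ℚ.1/ K)
    K⁻¹-nonNeg = ℚP.pos⇒nonNeg (ℚ.1/ K) {{ℚP.1/pos⇒pos K}}
    K-nonNeg : ℚ.NonNegative K
    K-nonNeg = ℚP.pos⇒nonNeg K
  bounded : InDilate d (suc k) u → ∀ p → Gen d p → ⟨ u , p ⟩ ℚ.≤ K
  bounded (α , α∈C* , u≗Kα) p gen = begin
    ⟨ u , p ⟩     ≡⟨ ⟨⟩-scaleˡ K p u≗Kα ⟩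
    K ℚ.* ⟨ α , p ⟩ ≤⟨ ℚP.*-monoˡ-≤-nonNeg K (α∈C* p (∈-convHull gen)) ⟩
    K ℚ.* 1ℚ      ≡⟨ ℚP.*-identityʳ K ⟩
    K             ∎
    where open ℚP.≤-Reasoning
  dilate : (∀ p → Gen d p → ⟨ u , p ⟩ ℚ.≤ K) → InDilate d (suc k) u
  dilate bound = α , convHull-bound α α-bound , u≗Kα
    where
    α : ℚ^ d
    α i = ℚ.1/ K ℚ.* u i
    α-bound : ∀ p → Gen d p → ⟨ α , p ⟩ ℚ.≤ 1ℚ
    α-bound p gen = begin
      ⟨ α , p ⟩           ≡⟨ ⟨⟩-scaleˡ (ℚ.1/ K) p (λ _ → refl) ⟩
      ℚ.1/ K ℚ.* ⟨ u , p ⟩ ≤⟨ ℚP.*-monoˡ-≤-nonNeg (ℚ.1/ K) (bound p gen) ⟩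
      ℚ.1/ K ℚ.* K        ≡⟨ ℚP.*-inverseˡ K ⟩
      1ℚ                  ∎
      where open ℚP.≤-Reasoning
    u≗Kα : ∀ i → u i ≡ K ℚ.* α i
    u≗Kα i = begin
      u i                    ≡⟨ ℚP.*-identityˡ (u i) ⟨
      1ℚ ℚ.* u i             ≡⟨ cong (ℚ._* u i) (ℚP.*-inverseʳ K) ⟨
      K ℚ.* ℚ.1/ K ℚ.* u i   ≡⟨ ℚP.*-assoc K (ℚ.1/ K) (u i) ⟩
      K ℚ.* α i              ∎
      where open ≡-Reasoning

dot : ∀ {d} → Vec ℤ d → (ℕ → ℤ) → ℤ
dot [] g = + 0
dot (x ∷ xs) g = x ℤ.* g 0 ℤ.+ dot xs (g ∘ suc)

dot-cong : ∀ {d} (z : Vec ℤ d) {g h : ℕ → ℤ} → (∀ m → g m ≡ h m) → dot z g ≡ dot z h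
dot-cong [] g≗h = refl
dot-cong (x ∷ z) g≗h = cong₂ (λ a b → x ℤ.* a ℤ.+ b) (g≗h 0) (dot-cong z (g≗h ∘ suc))

dot-zeroʳ : ∀ {d} (z : Vec ℤ d) → dot z (λ _ → + 0) ≡ + 0
dot-zeroʳ [] = refl
dot-zeroʳ (x ∷ z) =
  trans (cong (λ t → x ℤ.* + 0 ℤ.+ t) (dot-zeroʳ z)) (trans (ℤP.+-identityʳ _) (ℤP.*-zeroʳ x))

dot-neg : ∀ {d} (z : Vec ℤ d) g → dot z (ℤ.-_ ∘ g) ≡ ℤ.- dot z g
dot-neg [] g = refl
dot-neg (x ∷ z) g =
  trans (cong (λ t → x ℤ.* ℤ.- g 0 ℤ.+ t) (dot-neg z (g ∘ suc))) (neg-distrib x (g 0) (dot z (g ∘ suc)))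
  where
  neg-distrib : ∀ a b c → a ℤ.* ℤ.- b ℤ.+ ℤ.- c ≡ ℤ.- (a ℤ.* b ℤ.+ c)
  neg-distrib = solve-∀

unitℤ : ℕ → ℕ → ℤ
unitℤ a m = if m ≡ᵇ a then + 1 else + 0

blockℤ : ℕ → ℕ → ℕ → ℤ
blockℤ a b m = if (a ≤ᵇ m) ∧ (m ≤ᵇ b) then + 1 else + 0

tailℤ : ℕ → ℕ → ℕ → ℤ
tailℤ d a m = if suc m ≡ᵇ d then + 1 else (if a ≤ᵇ m then + 2 else + 0)

Profile : ∀ {d} → ℚ^ d → (ℕ → ℤ) → Set
Profile p g = ∀ i → p i ≡ ι (g (toℕ i))

eVec-profile : ∀ {d} a → Profile {d} (eVec a) (unitℤ a)
eVec-profile a i rewrite isYes≗does (toℕ i ℕ.≟ a) with toℕ i ≡ᵇ a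
... | true = refl
... | false = refl

blockVec-profile : ∀ {d} a b → Profile {d} (blockVec a b) (blockℤ a b)
blockVec-profile a b i with (a ≤ᵇ toℕ i) ∧ (toℕ i ≤ᵇ b)
... | true = refl
... | false = refl

tailVec-profile : ∀ {d} a → Profile {d} (tailVec a) (tailℤ d a)
tailVec-profile {d} a i with suc (toℕ i) ≡ᵇ d | a ≤ᵇ toℕ i
... | true | _ = refl
... | false | true = refl
... | false | false = refl

neg-profile : ∀ {d} {p : ℚ^ d} {g} → Profile p g → Profile (neg p) (ℤ.-_ ∘ g)
neg-profile {g = g} p≗g i = trans (cong ℚ.-_ (p≗g i)) (ι-neg (g (toℕ i)))

⟨⟩-profile : ∀ {d} (z : Vec ℤ d) {p g} → Profile p g → ⟨ toℚ^ z , p ⟩ ≡ ι (dot z g)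
⟨⟩-profile z p≗g = trans (⟨⟩-cong (toℚ^ z) p≗g) (go z _)
  where
  go : ∀ {d} (z : Vec ℤ d) g → ⟨ toℚ^ z , (λ i → ι (g (toℕ i))) ⟩ ≡ ι (dot z g)
  go [] g = refl
  go (x ∷ z) g = trans (cong₂ ℚ._+_ (ι-* x (g 0)) (go z (g ∘ suc))) (ι-+ (x ℤ.* g 0) (dot z (g ∘ suc)))

infix 4 ∣_∣≤_
∣_∣≤_ : ℤ → ℕ → Set
∣ x ∣≤ k = x ℤ.≤ + k × ℤ.- x ℤ.≤ + k

∣dot∣≤⇔ : ∀ {d} (z : Vec ℤ d) k {p g} → Profile p g →
  ∣ dot z g ∣≤ k ⇔ (⟨ toℚ^ z , p ⟩ ℚ.≤ ι (+ k) × ⟨ toℚ^ z , neg p ⟩ ℚ.≤ ι (+ k))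
∣dot∣≤⇔ z k {g = g} p≗g = mk⇔
  (λ (up , down) → subst (ℚ._≤ ι (+ k)) (sym ⟨z,p⟩) (ι-mono-≤ up) ,
                   subst (ℚ._≤ ι (+ k)) (sym ⟨z,-p⟩) (ι-mono-≤ down))
  (λ (up , down) → ι-cancel-≤ (subst (ℚ._≤ ι (+ k)) ⟨z,p⟩ up) ,
                   ι-cancel-≤ (subst (ℚ._≤ ι (+ k)) ⟨z,-p⟩ down))
  where
  ⟨z,p⟩ : ⟨ toℚ^ z , _ ⟩ ≡ ι (dot z g)
  ⟨z,p⟩ = ⟨⟩-profile z p≗g
  ⟨z,-p⟩ : ⟨ toℚ^ z , neg _ ⟩ ≡ ι (ℤ.- dot z g)
  ⟨z,-p⟩ = trans (⟨⟩-profile z (neg-profile {g = g} p≗g)) (cong ι (dot-neg z g))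

-- The coordinates Δ

-- Lookup with a natural-number index; the junk value + 0 past the end is never used.
infixl 9 _!_
_!_ : ∀ {n} → Vec ℤ n → ℕ → ℤ
[] ! _ = + 0
(x ∷ xs) ! zero = x
(x ∷ xs) ! suc a = xs ! a

-- Δ K w = (w₁ − w₀, …, w_{d−1} − w_{d−2}, K − 2w_{d−1}): every generator of C_d pairs
-- with Δ K w to ±(w_b − w_a) or ±(K − 2w_a).
Δ : ∀ {n} → ℤ → Vec ℤ (suc n) → Vec ℤ (suc n)
Δ K (w₀ ∷ []) = K ℤ.- (w₀ ℤ.+ w₀) ∷ []
Δ K (w₀ ∷ w₁ ∷ ws) = (w₁ ℤ.- w₀) ∷ Δ K (w₁ ∷ ws)

private
  m<ᵇ1+n≡m≤ᵇn : ∀ a m → (a <ᵇ suc m) ≡ (a ≤ᵇ m)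
  m<ᵇ1+n≡m≤ᵇn zero m = refl
  m<ᵇ1+n≡m≤ᵇn (suc a) m = refl

  zero*+ : ∀ a b → a ℤ.* + 0 ℤ.+ b ≡ b
  zero*+ = solve-∀

  *one+zero : ∀ a → a ℤ.* + 1 ℤ.+ + 0 ≡ a
  *one+zero = solve-∀

dot-Δ-tail : ∀ {n} K (w : Vec ℤ (suc n)) a → a ℕ.≤ n →
  dot (Δ K w) (tailℤ (suc n) a) ≡ K ℤ.- (w ! a ℤ.+ w ! a)
dot-Δ-tail K (w₀ ∷ []) zero _ = *one+zero _
dot-Δ-tail K (w₀ ∷ w₁ ∷ ws) zero _ =
  trans (cong (λ t → (w₁ ℤ.- w₀) ℤ.* + 2 ℤ.+ t) (dot-Δ-tail K (w₁ ∷ ws) zero ℕ.z≤n)) (telescope K w₀ w₁)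
  where
  telescope : ∀ K w₀ w₁ → (w₁ ℤ.- w₀) ℤ.* + 2 ℤ.+ (K ℤ.- (w₁ ℤ.+ w₁)) ≡ K ℤ.- (w₀ ℤ.+ w₀)
  telescope = solve-∀
dot-Δ-tail {suc n} K (w₀ ∷ w₁ ∷ ws) (suc a) (ℕ.s≤s a≤n) = begin
  (w₁ ℤ.- w₀) ℤ.* + 0 ℤ.+ dot (Δ K (w₁ ∷ ws)) (tailℤ (suc (suc n)) (suc a) ∘ suc)
    ≡⟨ zero*+ (w₁ ℤ.- w₀) _ ⟩
  dot (Δ K (w₁ ∷ ws)) (tailℤ (suc (suc n)) (suc a) ∘ suc)
    ≡⟨ dot-cong (Δ K (w₁ ∷ ws)) (λ m → cong (λ b → if suc m ≡ᵇ suc n then + 1 else (if b then + 2 else + 0)) (m<ᵇ1+n≡m≤ᵇn a m)) ⟩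
  dot (Δ K (w₁ ∷ ws)) (tailℤ (suc n) a)
    ≡⟨ dot-Δ-tail K (w₁ ∷ ws) a a≤n ⟩
  K ℤ.- ((w₁ ∷ ws) ! a ℤ.+ (w₁ ∷ ws) ! a) ∎
  where open ≡-Reasoning

dot-Δ-last : ∀ {n} K (w : Vec ℤ (suc n)) → dot (Δ K w) (unitℤ n) ≡ K ℤ.- (w ! n ℤ.+ w ! n)
dot-Δ-last K (w₀ ∷ []) = *one+zero _
dot-Δ-last K (w₀ ∷ w₁ ∷ ws) = trans (zero*+ (w₁ ℤ.- w₀) _) (dot-Δ-last K (w₁ ∷ ws))

dot-Δ-block : ∀ {n} K (w : Vec ℤ (suc n)) a b → a ℕ.≤ b → b ℕ.< n →
  dot (Δ K w) (blockℤ a b) ≡ w ! suc b ℤ.- w ! a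
dot-Δ-block K (w₀ ∷ w₁ ∷ ws) zero zero _ _ =
  trans (cong (λ t → (w₁ ℤ.- w₀) ℤ.* + 1 ℤ.+ t) (dot-zeroʳ (Δ K (w₁ ∷ ws)))) (*one+zero _)
dot-Δ-block K (w₀ ∷ w₁ ∷ ws) zero (suc b) _ (ℕ.s≤s b<n) =
  trans (cong (λ t → (w₁ ℤ.- w₀) ℤ.* + 1 ℤ.+ t)
          (trans (dot-cong (Δ K (w₁ ∷ ws)) (λ m → cong (if_then + 1 else + 0) (m<ᵇ1+n≡m≤ᵇn m b)))
                 (dot-Δ-block K (w₁ ∷ ws) zero b ℕ.z≤n b<n)))
        (telescope w₀ w₁ ((w₁ ∷ ws) ! suc b))
  where
  telescope : ∀ w₀ w₁ w₂ → (w₁ ℤ.- w₀) ℤ.* + 1 ℤ.+ (w₂ ℤ.- w₁) ≡ w₂ ℤ.- w₀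
  telescope = solve-∀
dot-Δ-block K (w₀ ∷ w₁ ∷ ws) (suc a) (suc b) (ℕ.s≤s a≤b) (ℕ.s≤s b<n) =
  trans (zero*+ (w₁ ℤ.- w₀) _)
    (trans (dot-cong (Δ K (w₁ ∷ ws)) (λ m → cong₂ (λ c e → if c ∧ e then + 1 else + 0) (m<ᵇ1+n≡m≤ᵇn a m) (m<ᵇ1+n≡m≤ᵇn m b)))
           (dot-Δ-block K (w₁ ∷ ws) a b a≤b b<n))

dot-Δ-unit : ∀ {n} K (w : Vec ℤ (suc n)) a → a ℕ.< n → dot (Δ K w) (unitℤ a) ≡ w ! suc a ℤ.- w ! a
dot-Δ-unit K (w₀ ∷ w₁ ∷ ws) zero _ =
  trans (cong (λ t → (w₁ ℤ.- w₀) ℤ.* + 1 ℤ.+ t) (dot-zeroʳ (Δ K (w₁ ∷ ws)))) (*one+zero _)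
dot-Δ-unit K (w₀ ∷ w₁ ∷ ws) (suc a) (ℕ.s≤s a<n) = trans (zero*+ (w₁ ℤ.- w₀) _) (dot-Δ-unit K (w₁ ∷ ws) a a<n)

private
  sub-sub : ∀ a b → a ℤ.- (a ℤ.- b) ≡ b
  sub-sub = solve-∀

Δ⁻¹ : ∀ {n} → ℤ → Vec ℤ (suc n) → Vec ℤ (suc n)
Δ⁻¹ q (z₀ ∷ []) = q ∷ []
Δ⁻¹ q (z₀ ∷ z₁ ∷ zs) with Δ⁻¹ q (z₁ ∷ zs)
... | w₁ ∷ ws = (w₁ ℤ.- z₀) ∷ w₁ ∷ ws

Δ∘Δ⁻¹ : ∀ {n} K q (z : Vec ℤ (suc n)) → K ℤ.- (q ℤ.+ q) ≡ Vec.last z → Δ K (Δ⁻¹ q z) ≡ z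
Δ∘Δ⁻¹ K q (z₀ ∷ []) eq = cong (_∷ []) eq
Δ∘Δ⁻¹ K q (z₀ ∷ z₁ ∷ zs) eq with Δ⁻¹ q (z₁ ∷ zs) | Δ∘Δ⁻¹ K q (z₁ ∷ zs) eq
... | w₁ ∷ ws | Δw≡z = cong₂ _∷_ (sub-sub w₁ z₀) Δw≡z

private
  sub-injectiveʳ : ∀ K {a b} → K ℤ.- a ≡ K ℤ.- b → a ≡ b
  sub-injectiveʳ K {a} {b} eq = trans (sym (sub-sub K a)) (trans (cong (λ t → K ℤ.- t) eq) (sub-sub K b))

  double-injective : ∀ {a b} → a ℤ.+ a ≡ b ℤ.+ b → a ≡ b
  double-injective {a} {b} eq = ℤP.*-cancelˡ-≡ (+ 2) a b (trans (double a) (trans eq (sym (double b))))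
    where
    double : ∀ a → + 2 ℤ.* a ≡ a ℤ.+ a
    double = solve-∀

Δ-injective : ∀ {n} K {w w′ : Vec ℤ (suc n)} → Δ K w ≡ Δ K w′ → w ≡ w′
Δ-injective K {w₀ ∷ []} {w₀′ ∷ []} eq =
  cong (_∷ []) (double-injective (sub-injectiveʳ K (VecP.∷-injectiveˡ eq)))
Δ-injective K {w₀ ∷ w₁ ∷ ws} {w₀′ ∷ w₁′ ∷ ws′} eq with Δ-injective K (VecP.∷-injectiveʳ eq)
... | refl = cong (_∷ w₁ ∷ ws) (sub-injectiveʳ w₁ (VecP.∷-injectiveˡ eq))

infix 4 _∈[0,_]
_∈[0,_] : ℤ → ℕ → Set
x ∈[0, K ] = + 0 ℤ.≤ x × x ℤ.≤ + K

private
  ≤-via-difference : ∀ {x y} e → y ℤ.- x ≡ e → + 0 ℤ.≤ e → x ℤ.≤ y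
  ≤-via-difference e y-x≡e 0≤e = ℤP.0≤i-j⇒j≤i (subst (+ 0 ℤ.≤_) (sym y-x≡e) 0≤e)

  0≤+ : ∀ {a b} → + 0 ℤ.≤ a → + 0 ℤ.≤ b → + 0 ℤ.≤ a ℤ.+ b
  0≤+ = ℤP.+-mono-≤

  0≤1+2i⇒0≤i : ∀ i → + 0 ℤ.≤ + 1 ℤ.+ (i ℤ.+ i) → + 0 ℤ.≤ i
  0≤1+2i⇒0≤i (+ n) _ = ℤ.+≤+ ℕ.z≤n
  0≤1+2i⇒0≤i -[1+ n ] ()

∣∣≤-mono : ∀ {k k′ x} → k ℕ.≤ k′ → ∣ x ∣≤ k → ∣ x ∣≤ k′
∣∣≤-mono k≤k′ (up , down) = ℤP.≤-trans up (ℤ.+≤+ k≤k′) , ℤP.≤-trans down (ℤ.+≤+ k≤k′)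

∈[0,K]⇒∣y-x∣≤K : ∀ {K x y} → x ∈[0, K ] → y ∈[0, K ] → ∣ y ℤ.- x ∣≤ K
∈[0,K]⇒∣y-x∣≤K {K} {x} {y} (0≤x , x≤K) (0≤y , y≤K) =
  ≤-via-difference _ (up (+ K) x y) (0≤+ (ℤP.i≤j⇒0≤j-i y≤K) 0≤x) ,
  ≤-via-difference _ (down (+ K) x y) (0≤+ (ℤP.i≤j⇒0≤j-i x≤K) 0≤y)
  where
  up : ∀ K x y → K ℤ.- (y ℤ.- x) ≡ (K ℤ.- y) ℤ.+ x
  up = solve-∀
  down : ∀ K x y → K ℤ.- ℤ.- (y ℤ.- x) ≡ (K ℤ.- x) ℤ.+ y
  down = solve-∀

∈[0,K]⇒∣K-2w∣≤K : ∀ {K w} → w ∈[0, K ] → ∣ + K ℤ.- (w ℤ.+ w) ∣≤ K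
∈[0,K]⇒∣K-2w∣≤K {K} {w} (0≤w , w≤K) =
  ≤-via-difference _ (up (+ K) w) (0≤+ 0≤w 0≤w) ,
  ≤-via-difference _ (down (+ K) w) (0≤+ K-w≥0 K-w≥0)
  where
  K-w≥0 = ℤP.i≤j⇒0≤j-i w≤K
  up : ∀ K w → K ℤ.- (K ℤ.- (w ℤ.+ w)) ≡ w ℤ.+ w
  up = solve-∀
  down : ∀ K w → K ℤ.- ℤ.- (K ℤ.- (w ℤ.+ w)) ≡ (K ℤ.- w) ℤ.+ (K ℤ.- w)
  down = solve-∀

∣K-2w∣≤1+K⇒w∈[0,K] : ∀ {K w} → ∣ + K ℤ.- (w ℤ.+ w) ∣≤ suc K → w ∈[0, K ]
∣K-2w∣≤1+K⇒w∈[0,K] {K} {w} (up , down) =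
  0≤1+2i⇒0≤i w (subst (+ 0 ℤ.≤_) (gap-up (+ K) w) (ℤP.i≤j⇒0≤j-i up)) ,
  ℤP.0≤i-j⇒j≤i (0≤1+2i⇒0≤i (+ K ℤ.- w) (subst (+ 0 ℤ.≤_) (gap-down (+ K) w) (ℤP.i≤j⇒0≤j-i down)))
  where
  gap-up : ∀ K w → (+ 1 ℤ.+ K) ℤ.- (K ℤ.- (w ℤ.+ w)) ≡ + 1 ℤ.+ (w ℤ.+ w)
  gap-up = solve-∀
  gap-down : ∀ K w → (+ 1 ℤ.+ K) ℤ.- ℤ.- (K ℤ.- (w ℤ.+ w)) ≡ + 1 ℤ.+ ((K ℤ.- w) ℤ.+ (K ℤ.- w))
  gap-down = solve-∀

split-parity : ∀ k x → (∃ λ q → + suc k ℤ.- (q ℤ.+ q) ≡ x) ⊎ (∃ λ q → + k ℤ.- (q ℤ.+ q) ≡ x)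
split-parity k x with (+ suc k ℤ.- x) %ℕ 2 | n%ℕd<d (+ suc k ℤ.- x) 2 | a≡a%ℕn+[a/ℕn]*n (+ suc k ℤ.- x) 2
... | 0 | _ | eq = inj₁ (q , trans (cong (λ t → + suc k ℤ.- t) (sym (trans eq (even q)))) (sub-sub (+ suc k) x))
  where
  q = (+ suc k ℤ.- x) /ℕ 2
  even : ∀ q → + 0 ℤ.+ q ℤ.* + 2 ≡ q ℤ.+ q
  even = solve-∀
... | 1 | _ | eq = inj₂ (q , trans (odd (+ k) q) (trans (cong (λ t → + suc k ℤ.- t) (sym eq)) (sub-sub (+ suc k) x)))
  where
  q = (+ suc k ℤ.- x) /ℕ 2
  odd : ∀ K q → K ℤ.- (q ℤ.+ q) ≡ (+ 1 ℤ.+ K) ℤ.- (+ 1 ℤ.+ q ℤ.* + 2)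
  odd = solve-∀
... | suc (suc _) | ℕ.s≤s (ℕ.s≤s ()) | _

-- Enumerating integer boxes

length-cartesianProductWith : ∀ {A B C : Set} (f : A → B → C) xs ys →
  length (cartesianProductWith f xs ys) ≡ length xs ℕ.* length ys
length-cartesianProductWith f List.[] ys = refl
length-cartesianProductWith f (x List.∷ xs) ys = begin
  length (map (f x) ys ++ cartesianProductWith f xs ys)          ≡⟨ ListP.length-++ (map (f x) ys) ⟩
  length (map (f x) ys) ℕ.+ length (cartesianProductWith f xs ys) ≡⟨ cong₂ ℕ._+_ (ListP.length-map (f x) ys)
                                                                        (length-cartesianProductWith f xs ys) ⟩
  length ys ℕ.+ length xs ℕ.* length ys                          ∎
  where open ≡-Reasoning

vectorsOver : ∀ {A : Set} → List A → (n : ℕ) → List (Vec A n)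
vectorsOver xs zero = [] List.∷ List.[]
vectorsOver xs (suc n) = cartesianProductWith _∷_ xs (vectorsOver xs n)

length-vectorsOver : ∀ {A : Set} (xs : List A) n → length (vectorsOver xs n) ≡ length xs ℕ.^ n
length-vectorsOver xs zero = refl
length-vectorsOver xs (suc n) =
  trans (length-cartesianProductWith _∷_ xs (vectorsOver xs n))
        (cong (length xs ℕ.*_) (length-vectorsOver xs n))

vectorsOver-unique : ∀ {A : Set} {xs : List A} n → Unique xs → Unique (vectorsOver xs n)
vectorsOver-unique zero _ = ListAll.[] AllPairs.∷ AllPairs.[]
vectorsOver-unique (suc n) xs! =
  Unique.cartesianProductWith⁺ _∷_ VecP.∷-injective xs! (vectorsOver-unique n xs!)

∈-vectorsOver⇔ : ∀ {A : Set} {xs : List A} {n} {v : Vec A n} → v ∈ vectorsOver xs n ⇔ All (_∈ xs) v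
∈-vectorsOver⇔ = mk⇔ to from
  where
  to : ∀ {A : Set} {xs : List A} {n} {v : Vec A n} → v ∈ vectorsOver xs n → All (_∈ xs) v
  to {v = []} _ = []
  to {xs = xs} {suc n} {x ∷ v} x∷v∈ with ∈-cartesianProductWith⁻ _∷_ xs (vectorsOver xs n) x∷v∈
  ... | x′ , v′ , x′∈ , v′∈ , eq with VecP.∷-injective eq
  ... | refl , refl = x′∈ ∷ to v′∈
  from : ∀ {A : Set} {xs : List A} {n} {v : Vec A n} → All (_∈ xs) v → v ∈ vectorsOver xs n
  from [] = Any.here refl
  from (x∈ ∷ v∈) = ∈-cartesianProductWith⁺ _∷_ x∈ (from v∈)

All⇔! : ∀ {P : ℤ → Set} {n} {w : Vec ℤ n} → All P w ⇔ (∀ a → a ℕ.< n → P (w ! a))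
All⇔! = mk⇔ to from
  where
  to : ∀ {P : ℤ → Set} {n} {w : Vec ℤ n} → All P w → ∀ a → a ℕ.< n → P (w ! a)
  to (px ∷ _) zero _ = px
  to (_ ∷ pxs) (suc a) (ℕ.s≤s a<n) = to pxs a a<n
  from : ∀ {P : ℤ → Set} {n} {w : Vec ℤ n} → (∀ a → a ℕ.< n → P (w ! a)) → All P w
  from {w = []} _ = []
  from {w = x ∷ w} P! = P! 0 (ℕ.s≤s ℕ.z≤n) ∷ from (λ a a<n → P! (suc a) (ℕ.s≤s a<n))

interval : ℕ → List ℤ
interval K = map +_ (upTo (suc K))

∈-interval⇔ : ∀ {K x} → x ∈ interval K ⇔ x ∈[0, K ]
∈-interval⇔ {K} = mk⇔ to from
  where
  to : ∀ {x} → x ∈ interval K → x ∈[0, K ]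
  to x∈ with ∈-map⁻ +_ x∈
  ... | n , n∈ , refl = ℤ.+≤+ ℕ.z≤n , ℤ.+≤+ (ℕ.≤-pred (∈-upTo⁻ n∈))
  from : ∀ {x} → x ∈[0, K ] → x ∈ interval K
  from (ℤ.+≤+ _ , ℤ.+≤+ n≤K) = ∈-map⁺ +_ (∈-upTo⁺ (ℕ.s≤s n≤K))

box : ℕ → (n : ℕ) → List (Vec ℤ n)
box K = vectorsOver (interval K)

∈-box⇔ : ∀ {K n} {w : Vec ℤ n} → w ∈ box K n ⇔ (∀ a → a ℕ.< n → w ! a ∈[0, K ])
∈-box⇔ = mk⇔
  (λ w∈ → Equivalence.to All⇔! (AllV.map (Equivalence.to ∈-interval⇔) (Equivalence.to ∈-vectorsOver⇔ w∈)))
  (λ w! → Equivalence.from ∈-vectorsOver⇔ (AllV.map (Equivalence.from ∈-interval⇔) (Equivalence.from All⇔! w!)))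

box-unique : ∀ K n → Unique (box K n)
box-unique K n = vectorsOver-unique n (Unique.map⁺ ℤP.+-injective (Unique.upTo⁺ (suc K)))

length-box : ∀ K n → length (box K n) ≡ suc K ℕ.^ n
length-box K n = trans (length-vectorsOver (interval K) n)
  (cong (ℕ._^ n) (trans (ListP.length-map +_ (upTo (suc K))) (ListP.length-upTo (suc K))))

-- Lattice points of kC_d^*

ΔImage : ℕ → (n : ℕ) → List (Vec ℤ (suc n))
ΔImage K n = map (Δ (+ K)) (box K (suc n))

ΔImage-unique : ∀ K n → Unique (ΔImage K n)
ΔImage-unique K n = Unique.map⁺ (Δ-injective (+ K)) (box-unique K (suc n))

length-ΔImage : ∀ K n → length (ΔImage K n) ≡ suc K ℕ.^ suc n
length-ΔImage K n = trans (ListP.length-map (Δ (+ K)) (box K (suc n))) (length-box K (suc n))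

ΔImage-disjoint : ∀ k n {z} → ¬ (z ∈ ΔImage (suc k) n × z ∈ ΔImage k n)
ΔImage-disjoint k n (z∈ , z∈′) with ∈-map⁻ (Δ (+ suc k)) z∈ | ∈-map⁻ (Δ (+ k)) z∈′
... | w , _ , refl | w′ , _ , Δw≡Δw′ =
  1+2i≢0 (w′ ! n ℤ.- w ! n) (trans (gap (+ k) (w ! n) (w′ ! n)) (ℤP.i≡j⇒i-j≡0 last≡))
  where
  last≡ : + suc k ℤ.- (w ! n ℤ.+ w ! n) ≡ + k ℤ.- (w′ ! n ℤ.+ w′ ! n)
  last≡ = trans (sym (dot-Δ-last (+ suc k) w))
    (trans (cong (λ z → dot z (unitℤ n)) Δw≡Δw′) (dot-Δ-last (+ k) w′))
  gap : ∀ K a b → + 1 ℤ.+ ((b ℤ.- a) ℤ.+ (b ℤ.- a)) ≡ (+ 1 ℤ.+ K ℤ.- (a ℤ.+ a)) ℤ.- (K ℤ.- (b ℤ.+ b))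
  gap = solve-∀
  1+2i≢0 : ∀ i → + 1 ℤ.+ (i ℤ.+ i) ≢ + 0
  1+2i≢0 (+ n) ()
  1+2i≢0 -[1+ n ] ()

Δ-dual-bound : ∀ {n k K} {w : Vec ℤ (suc n)} → K ℕ.≤ k → w ∈ box K (suc n) →
  ∀ {p} → Gen (suc n) p → ⟨ toℚ^ (Δ (+ K) w) , p ⟩ ℚ.≤ ι (+ k)
Δ-dual-bound {n} {k} {K} {w} K≤k w∈box = bound
  where
  z = Δ (+ K) w
  w∈[0,K] : ∀ a → a ℕ.< suc n → w ! a ∈[0, K ]
  w∈[0,K] = Equivalence.to ∈-box⇔ w∈box
  ±bound : ∀ {p g} → Profile p g → ∣ dot z g ∣≤ K →
    ⟨ toℚ^ z , p ⟩ ℚ.≤ ι (+ k) × ⟨ toℚ^ z , neg p ⟩ ℚ.≤ ι (+ k)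
  ±bound p≗g z·g≤K = Equivalence.to (∣dot∣≤⇔ z k p≗g) (∣∣≤-mono K≤k z·g≤K)
  unit-bound : ∀ a → a ℕ.< suc n → ∣ dot z (unitℤ a) ∣≤ K
  unit-bound a a<1+n with ℕP.m≤n⇒m<n∨m≡n (ℕP.≤-pred a<1+n)
  ... | inj₁ a<n = subst (∣_∣≤ K) (sym (dot-Δ-unit (+ K) w a a<n))
                         (∈[0,K]⇒∣y-x∣≤K (w∈[0,K] a a<1+n) (w∈[0,K] (suc a) (ℕ.s≤s a<n)))
  ... | inj₂ refl = subst (∣_∣≤ K) (sym (dot-Δ-last (+ K) w)) (∈[0,K]⇒∣K-2w∣≤K (w∈[0,K] n a<1+n))
  block-bound : ∀ a b → a ℕ.< b → b ℕ.< n → ∣ dot z (blockℤ a b) ∣≤ K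
  block-bound a b a<b b<n = subst (∣_∣≤ K) (sym (dot-Δ-block (+ K) w a b (ℕP.<⇒≤ a<b) b<n))
    (∈[0,K]⇒∣y-x∣≤K (w∈[0,K] a (ℕP.<-trans a<b (ℕP.m<n⇒m<1+n b<n))) (w∈[0,K] (suc b) (ℕ.s≤s b<n)))
  tail-bound : ∀ a → a ℕ.< n → ∣ dot z (tailℤ (suc n) a) ∣≤ K
  tail-bound a a<n = subst (∣_∣≤ K) (sym (dot-Δ-tail (+ K) w a (ℕP.<⇒≤ a<n)))
    (∈[0,K]⇒∣K-2w∣≤K (w∈[0,K] a (ℕP.m<n⇒m<1+n a<n)))
  bound : ∀ {p} → Gen (suc n) p → ⟨ toℚ^ z , p ⟩ ℚ.≤ ι (+ k)
  bound (gE a a<d) = proj₁ (±bound (eVec-profile a) (unit-bound a a<d))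
  bound (gE⁻ a a<d) = proj₂ (±bound (eVec-profile a) (unit-bound a a<d))
  bound (gB a b a<b (ℕ.s≤s b<n)) = proj₁ (±bound (blockVec-profile a b) (block-bound a b a<b b<n))
  bound (gB⁻ a b a<b (ℕ.s≤s b<n)) = proj₂ (±bound (blockVec-profile a b) (block-bound a b a<b b<n))
  bound (gT a (ℕ.s≤s a<n)) = proj₁ (±bound (tailVec-profile a) (tail-bound a a<n))
  bound (gT⁻ a (ℕ.s≤s a<n)) = proj₂ (±bound (tailVec-profile a) (tail-bound a a<n))

ΔImage-dual-bound : ∀ {n k K} {z : Vec ℤ (suc n)} → K ℕ.≤ k → z ∈ ΔImage K n →
  ∀ p → Gen (suc n) p → ⟨ toℚ^ z , p ⟩ ℚ.≤ ι (+ k)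
ΔImage-dual-bound K≤k z∈ p gen with ∈-map⁻ _ z∈
... | w , w∈box , refl = Δ-dual-bound K≤k w∈box gen

module _ {n k} {z : Vec ℤ (suc n)} (bound : ∀ p → Gen (suc n) p → ⟨ toℚ^ z , p ⟩ ℚ.≤ ι (+ suc k)) where

  private
    ±generator-bound : ∀ {p g} → Gen (suc n) p → Gen (suc n) (neg p) → Profile p g → ∣ dot z g ∣≤ suc k
    ±generator-bound gen gen⁻ p≗g = Equivalence.from (∣dot∣≤⇔ z (suc k) p≗g) (bound _ gen , bound _ gen⁻)

  K-2q≡last⇒∈ΔImage : ∀ K q → + K ℤ.- (q ℤ.+ q) ≡ Vec.last z → k ℕ.≤ K → z ∈ ΔImage K n
  K-2q≡last⇒∈ΔImage K q K-2q≡last k≤K =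
    subst (_∈ ΔImage K n) Δw≡z (∈-map⁺ (Δ (+ K)) (Equivalence.from ∈-box⇔ w∈[0,K]))
    where
    w = Δ⁻¹ q z
    Δw≡z : Δ (+ K) w ≡ z
    Δw≡z = Δ∘Δ⁻¹ (+ K) q z K-2q≡last
    rewrite-z : ∀ g {x} → dot (Δ (+ K) w) g ≡ x → dot z g ≡ x
    rewrite-z g = trans (cong (λ v → dot v g) (sym Δw≡z))
    K-2w-bound : ∀ a → a ℕ.< suc n → ∣ + K ℤ.- (w ! a ℤ.+ w ! a) ∣≤ suc k
    K-2w-bound a a<1+n with ℕP.m≤n⇒m<n∨m≡n (ℕP.≤-pred a<1+n)
    ... | inj₁ a<n = subst (∣_∣≤ suc k) (rewrite-z _ (dot-Δ-tail (+ K) w a (ℕP.<⇒≤ a<n)))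
      (±generator-bound (gT a (ℕ.s≤s a<n)) (gT⁻ a (ℕ.s≤s a<n)) (tailVec-profile a))
    ... | inj₂ refl = subst (∣_∣≤ suc k) (rewrite-z _ (dot-Δ-last (+ K) w))
      (±generator-bound (gE n a<1+n) (gE⁻ n a<1+n) (eVec-profile n))
    w∈[0,K] : ∀ a → a ℕ.< suc n → w ! a ∈[0, K ]
    w∈[0,K] a a<1+n = ∣K-2w∣≤1+K⇒w∈[0,K] (∣∣≤-mono (ℕ.s≤s k≤K) (K-2w-bound a a<1+n))

  dual-bound⇒∈ΔImages : z ∈ ΔImage (suc k) n ++ ΔImage k n
  dual-bound⇒∈ΔImages with split-parity k (Vec.last z)
  ... | inj₁ (q , eq) = ∈-++⁺ˡ (K-2q≡last⇒∈ΔImage (suc k) q eq (ℕP.n≤1+n k))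
  ... | inj₂ (q , eq) = ∈-++⁺ʳ (ΔImage (suc k) n) (K-2q≡last⇒∈ΔImage k q eq ℕP.≤-refl)

theorem1 : (d : ℕ) → 1 ≤ d → (k : ℕ) → 1 ≤ k →
    Σ (List (Vec ℤ d)) (λ L →
    Unique L × ((z : Vec ℤ d) → (z ∈ L ⇔ LatticePt d k z)) ×
    length L ≡ suc k ^ d + k ^ d)
theorem1 (suc n) _ (suc k) _ =
  ΔImage (suc k) n ++ ΔImage k n ,
  Unique.++⁺ (ΔImage-unique (suc k) n) (ΔImage-unique k n) (ΔImage-disjoint k n) ,
  (λ z → mk⇔ (Equivalence.from (inDilate⇔ (suc n) k (toℚ^ z)) ∘ dual-bound)
             (dual-bound⇒∈ΔImages ∘ Equivalence.to (inDilate⇔ (suc n) k (toℚ^ z)))) ,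
  trans (ListP.length-++ (ΔImage (suc k) n)) (cong₂ _+_ (length-ΔImage (suc k) n) (length-ΔImage k n))
  where
  dual-bound : ∀ {z} → z ∈ ΔImage (suc k) n ++ ΔImage k n →
    ∀ p → Gen (suc n) p → ⟨ toℚ^ z , p ⟩ ℚ.≤ ι (+ suc k)
  dual-bound z∈ =
    [ ΔImage-dual-bound ℕP.≤-refl , ΔImage-dual-bound (ℕP.n≤1+n k) ]′ (∈-++⁻ (ΔImage (suc k) n) z∈)
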